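{- Consider an execution of the procedure \texttt{search}$(\mathcal{G},T)$ described below. In each full pass of the inner while loop (the top-down decomposition), the last (lowest) region $Z$ computed, with its strategy $\sigma$, satisfies that \texttt{extract-tangles}$(Z,\sigma)$ returns at least one tangle.
   Context: Parity games: $\mathcal{G}=(V_0,V_1,E,\mathsf{pr})$ with finite $V=V_0\cup V_1$ (Even owns $V_0$, Odd owns $V_1$), left-total $E\subseteq V\times V$, $\mathsf{pr}:V\to\{0,\dots,d\}$; plays are infinite paths, won by Even iff the highest priority seen infinitely often is even; $\overline{\alpha}$ is the opponent of $\alpha$; strategies are partial functions $\sigma\subseteq E$ on $V_\alpha$. A $p$-tangle is a nonempty $U\subseteq V$ with $p=\max\mathsf{pr}(U)$ and a witness strategy $\sigma_T(U):U\cap V_\alpha\to U$ of player $\alpha\equiv p\pmod 2$ such that $(U, E\cap(\sigma_T(U)\cup((U\cap V_{\overline\alpha})\times U)))$ is strongly connected and all its cycles have highest priority of parity $\alpha$. For a tangle $t$ of $\alpha$, $E_T(t)=\{v\in V\setminus t\mid \exists u\in t\cap V_{\overline\alpha}, (u,v)\in E\}$ (edges taken in the full game $\mathcal{G}$). For $U\subseteq V$, $\mathcal{G}\cap U$ is the subgame induced by $U$, and for a set of tangles $T$, $T\cap U=\{t\in T\mid t\subseteq U\}$. Tangle attractor: for a game $\mathcal{G}'$ with vertices $V'$, a set $T'$ of tangles and $A\subseteq V'$, $\mathit{TAttr}^{\mathcal{G}',T'}_\alpha(A)$ is the least fixed point $Z$ of $Z=A\cup\{v\in V'_\alpha\mid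 E(v)\cap Z\ne\emptyset\}\cup\{v\in V'_{\overline\alpha}\mid E(v)\subseteq Z\}\cup\{v\in t\mid t\in T',\ \mathsf{pr}(t)\equiv\alpha \pmod 2,\ E_T(t)\neq\emptyset,\ E_T(t)\subseteq Z\}$ (with edges in $\mathcal{G}'$). It also yields a strategy $\sigma$ of $\alpha$: when an $\alpha$-vertex is added because of a successor in $Z$, $\sigma$ picks that successor; $\alpha$-vertices of $A$ get a successor in $Z$ when the backward search finds one; when the vertices of a tangle $t$ are added (tangles processed one at a time), $\sigma$ is extended by $\{(u,v)\in\sigma_T(t)\mid u\notin\mathrm{dom}(\sigma)\}$. \texttt{extract-tangles}$(Z,\sigma)$: compute the greatest $X\subseteq Z$ with $X=Z\cap(\{v\in V_{\overline\alpha}\mid E'(v)\subseteq X\}\cup\{v\in V_\alpha\mid\sigma(v)\in X\})$, where $E'$ are edges of the current subgame $\mathcal{G}'$; return the set of nontrivial bottom strongly connected components of the graph on $X$ whose edges are all $E'$-edges from $\overline\alpha$-vertices and the $\sigma$-edges from $\alpha$-vertices, each with witness strategy $\sigma$ restricted to it. \texttt{search}$(\mathcal{G},T)$: repeat forever: set the region function $\mathsf{r}:=\emptyset$ (a partial map $V\to\{0,\dots,d\}$) and $Y:=\emptyset$; while $V\setminus\mathrm{dom}(\mathsf{r})\ne\emptyset$: let $\mathcal{G}'=\mathcal{G}\cap(V\setminus\mathrm{dom}(\mathsf{r}))$, $T'=T\cap(V\setminus\mathrm{dom}(\mathsf{r}))$, $p$ the highest priority in $\mathcal{G}'$, $\alpha=p\bmod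 2$; compute $(Z,\sigma)=\mathit{TAttr}^{\mathcal{G}',T'}_\alpha(\{v\in\mathcal{G}'\mid\mathsf{pr}(v)=p\})$ (the region of priority $p$); $A:=$\texttt{extract-tangles}$(Z,\sigma)$; if some $t\in A$ has $E_T(t)=\emptyset$, return $(T\cup Y,t)$; otherwise set $\mathsf{r}(v):=p$ for all $v\in Z$ and $Y:=Y\cup A$. After the while loop, set $T:=T\cup Y$. -}

module Defs where

open import Data.Nat using (ℕ; zero; suc; _≤_; _⊔_)
import Data.Nat
open import Data.Fin using (Fin)
import Data.Fin as Fin
open import Data.Bool using (Bool; true; false; _∨_; _∧_; if_then_else_; not)
open import Data.Maybe using (Maybe; just; nothing; is-nothing)
open import Data.List using (List; []; _∷_; _++_; foldr; map)
open import Data.List.Membership.Propositional using () renaming (_∈_ to _∈ₗ_)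
open import Data.Empty using (⊥)
open import Data.List.Relation.Unary.Linked using (Linked)
open import Data.Product using (Σ; ∃; _×_; _,_)
open import Data.Sum using (_⊎_)
open import Relation.Binary.PropositionalEquality using (_≡_; _≢_)
open import Relation.Binary.Construct.Closure.ReflexiveTransitive using (Star)
open import Relation.Nullary using (¬_; does)

data Player : Set where
  even odd : Player

opp : Player → Player
opp even = odd
opp odd  = even

parity : ℕ → Player
parity zero          = even
parity (suc zero)    = odd
parity (suc (suc p)) = parity p

VSet : ℕ → Set
VSet n = Fin n → Bool

module _ {n : ℕ} where
  infix 4 _∈_ _∉_ _⊆_
  _∈_ : Fin n → VSet n → Set
  v ∈ U = U v ≡ true

  _∉_ : Fin n → VSet n → Set
  v ∉ U = ¬ (v ∈ U)

  _⊆_ : VSet n → VSet n → Set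
  U ⊆ W = ∀ v → v ∈ U → v ∈ W

  _∪_ : VSet n → VSet n → VSet n
  (U ∪ W) v = U v ∨ W v

  ⁅_⁆ : Fin n → VSet n
  ⁅ v ⁆ u = does (u Fin.≟ v)

  fullSet : VSet n
  fullSet _ = true

-- Parity games: V = Fin n, owner gives V₀ / V₁, Boolean edge relation

record Game (n : ℕ) : Set where
  field
    owner     : Fin n → Player
    edge      : Fin n → Fin n → Bool
    pr        : Fin n → ℕ
    leftTotal : ∀ v → ∃ λ w → edge v w ≡ true

Strategy : ℕ → Set
Strategy n = Fin n → Maybe (Fin n)

record TangleData (n : ℕ) : Set where
  constructor mkTangle
  field
    verts : VSet n
    strat : Strategy n
open TangleData public

module _ {n : ℕ} where
  update : Strategy n → Fin n → Fin n → Strategy n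
  update σ v w u = if does (u Fin.≟ v) then just w else σ u

  extendStrat : Strategy n → Strategy n → Strategy n
  extendStrat σ τ u with σ u
  ... | just w  = just w
  ... | nothing = τ u

  restrict : Strategy n → VSet n → Strategy n
  restrict σ C u = if C u then σ u else nothing

module GameDefs {n : ℕ} (G : Game n) where
  open Game G

  E : Fin n → Fin n → Set
  E u v = edge u v ≡ true

  E' : VSet n → Fin n → Fin n → Set
  E' V' u v = u ∈ V' × v ∈ V' × E u v

  MaxPr : VSet n → ℕ → Set
  MaxPr U p = (∃ λ v → v ∈ U × pr v ≡ p) × (∀ v → v ∈ U → pr v ≤ p)

  maxPrList : List (Fin n) → ℕ
  maxPrList vs = foldr _⊔_ 0 (map pr vs)

  TangleGraph : VSet n → Strategy n → Player → Fin n → Fin n → Set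
  TangleGraph U τ α x y =
    x ∈ U × y ∈ U × ((owner x ≡ α × τ x ≡ just y × E x y) ⊎ (owner x ≡ opp α × E x y))

  -- a cycle  v₀ → v₁ → … → v_k → v₀  of a graph R, given by its vertex list v₀ … v_k
  IsCycle : (Fin n → Fin n → Set) → List (Fin n) → Set
  IsCycle R []       = ⊥
  IsCycle R (v ∷ vs) = Linked R (v ∷ vs ++ v ∷ [])

  IsTangle : TangleData n → Set
  IsTangle t = Σ ℕ λ p → MaxPr U p ×
      (∀ u → u ∈ U → owner u ≡ parity p → ∃ λ w → τ u ≡ just w × w ∈ U × E u w) ×
      (∀ u w → τ u ≡ just w → u ∈ U × owner u ≡ parity p) ×
      (∀ u v → u ∈ U → v ∈ U → Star (TangleGraph U τ (parity p)) u v) ×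
      (∀ cyc → IsCycle (TangleGraph U τ (parity p)) cyc → parity (maxPrList cyc) ≡ parity p)
    where
      U = verts t
      τ = strat t

  InET : VSet n → TangleData n → Player → Fin n → Set
  InET V' t α v = v ∈ V' × v ∉ verts t ×
    (∃ λ u → u ∈ verts t × owner u ≡ opp α × E' V' u v)

  -- Tangle attractor TAttr^{G∩V',T'}_α(A), with its strategy, as the
  -- set of all possible runs of the (nondeterministic order) backward search

  record AttrState : Set where
    constructor ⟨_,_⟩
    field
      Zset : VSet n
      σset : Strategy n

  data AttrStep (V' : VSet n) (Ts : List (TangleData n)) (α : Player) (A : VSet n)
       : AttrState → AttrState → Set where
    attrOwn : ∀ {Z σ} v w → v ∈ V' → v ∉ Z → owner v ≡ α → E' V' v w → w ∈ Z →
              AttrStep V' Ts α A ⟨ Z , σ ⟩ ⟨ Z ∪ ⁅ v ⁆ , update σ v w ⟩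
    attrOpp : ∀ {Z σ} v → v ∈ V' → v ∉ Z → owner v ≡ opp α →
              (∀ w → E' V' v w → w ∈ Z) →
              AttrStep V' Ts α A ⟨ Z , σ ⟩ ⟨ Z ∪ ⁅ v ⁆ , σ ⟩
    attrTop : ∀ {Z σ} v w → v ∈ A → owner v ≡ α → σ v ≡ nothing → E' V' v w → w ∈ Z →
              AttrStep V' Ts α A ⟨ Z , σ ⟩ ⟨ Z , update σ v w ⟩
    attrTangle : ∀ {Z σ} t → t ∈ₗ Ts → verts t ⊆ V' →
              (∃ λ q → MaxPr (verts t) q × parity q ≡ α) →
              (∃ λ v → InET V' t α v) →
              (∀ v → InET V' t α v → v ∈ Z) →
              (∃ λ v → v ∈ verts t × v ∉ Z) →
              AttrStep V' Ts α A ⟨ Z , σ ⟩ ⟨ Z ∪ verts t , extendStrat σ (strat t) ⟩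

  TAttrResult : VSet n → List (TangleData n) → Player → VSet n → VSet n → Strategy n → Set
  TAttrResult V' Ts α A Z σ =
    Star (AttrStep V' Ts α A) ⟨ A , (λ _ → nothing) ⟩ ⟨ Z , σ ⟩ ×
    (∀ s → ¬ AttrStep V' Ts α A ⟨ Z , σ ⟩ s)

  XOp : VSet n → Player → VSet n → Strategy n → VSet n → Fin n → Set
  XOp V' α Z σ X v = v ∈ Z ×
    ((owner v ≡ opp α × (∀ w → E' V' v w → w ∈ X)) ⊎
     (owner v ≡ α × ∃ λ w → σ v ≡ just w × w ∈ X))

  IsGreatestX : VSet n → Player → VSet n → Strategy n → VSet n → Set
  IsGreatestX V' α Z σ X =
    (∀ v → v ∈ X → XOp V' α Z σ X v) ×
    (∀ v → XOp V' α Z σ X v → v ∈ X) ×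
    (∀ Y → (∀ v → v ∈ Y → XOp V' α Z σ Y v) → Y ⊆ X)

  HGraph : VSet n → Player → Strategy n → VSet n → Fin n → Fin n → Set
  HGraph V' α σ X u v = u ∈ X × v ∈ X ×
    ((owner u ≡ opp α × E' V' u v) ⊎ (owner u ≡ α × σ u ≡ just v))

  NontrivialBSCC : (Fin n → Fin n → Set) → VSet n → VSet n → Set
  NontrivialBSCC R X C =
    (∃ λ v → v ∈ C) × C ⊆ X ×
    (∀ u v → u ∈ C → v ∈ C → Star R u v) ×
    (∀ v → (∃ λ u → u ∈ C × Star R u v × Star R v u) → v ∈ C) ×
    (∀ u v → u ∈ C → R u v → v ∈ C) ×
    (∃ λ u → ∃ λ v → u ∈ C × v ∈ C × R u v)

  ExtractTangles : VSet n → Player → VSet n → Strategy n → List (TangleData n) → Set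
  ExtractTangles V' α Z σ A = Σ (VSet n) λ X → IsGreatestX V' α Z σ X ×
    (∀ a → a ∈ₗ A → NontrivialBSCC (HGraph V' α σ X) X (verts a) ×
                    (∀ v → strat a v ≡ restrict σ (verts a) v)) ×
    (∀ C → NontrivialBSCC (HGraph V' α σ X) X C → ∃ λ a → a ∈ₗ A × (∀ v → verts a v ≡ C v))

  record SearchState : Set where
    constructor state
    field
      Tcur : List (TangleData n)
      reg  : Fin n → Maybe ℕ
      Ycur : List (TangleData n)
  open SearchState public

  free : (Fin n → Maybe ℕ) → VSet n
  free r v = is-nothing (r v)

  initState : List (TangleData n) → SearchState
  initState T = state T (λ _ → nothing) []

  RegionComputation : SearchState → ℕ → Player → VSet n → Strategy n → List (TangleData n) → Set
  RegionComputation s p α Z σ A =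
    (∃ λ v → v ∈ V') × MaxPr V' p × α ≡ parity p ×
    TAttrResult V' (Tcur s) α (λ v → V' v ∧ does (pr v Data.Nat.≟ p)) Z σ ×
    ExtractTangles V' α Z σ A
    where
      V' = free (reg s)

  setRegion : (Fin n → Maybe ℕ) → VSet n → ℕ → Fin n → Maybe ℕ
  setRegion r Z p v = if Z v then just p else r v

  data SearchStep : SearchState → SearchState → Set where
    -- while-loop iteration that does not return
    region : ∀ {s p α Z σ A} → RegionComputation s p α Z σ A →
             (∀ t → t ∈ₗ A → ∃ λ v → InET fullSet t α v) →
             SearchStep s (state (Tcur s) (setRegion (reg s) Z p) (Ycur s ++ A))
    endPass : ∀ {s} → (∀ v → v ∉ free (reg s)) →
              SearchStep s (state (Tcur s ++ Ycur s) (λ _ → nothing) [])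

-- In the lowest region every free vertex lies in Z, so the ᾱ-vertices of Z have all their moves
-- inside Z, and every α-vertex of Z has a strategy move into Z: vertices of top priority get one
-- because the attractor is maximal, all others when they are attracted.  Thus Z is a post-fixed
-- point of the operator defining X, so X ⊇ Z is nonempty and every vertex of the graph on X has a
-- successor; such a finite graph has a nontrivial bottom SCC, which extract-tangles must return.
-- Attracting a tangle supplies moves for its α-vertices only if its top priority has parity α.
-- This holds along the whole search because every cycle of an attractor graph has top priority
-- of parity α: a cycle either meets the vertices of top priority or stays inside one attracted
-- tangle, and the tangles extracted from a region inherit this from its attractor graph.
module Submission where

open import Defs
open import Data.Nat using (ℕ; zero; suc; _≤_; z≤n; s≤s)
open import Data.Nat.Properties
  using (≤-refl; ≤-antisym; <-≤-trans; <-irrefl; ≤-pred; m≤n⇒m≤1+n; n≤1+n; m≤n⇒m<n∨m≡n; ≡ᵇ⇒≡; ⊔-lub; m≥n⇒m⊔n≡m)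
import Data.Nat as ℕ
open import Data.Fin using (Fin)
import Data.Fin as Fin
import Data.Fin.Properties as Fin
open import Data.Fin.Subset using (_⊂_; ∣_∣) renaming (_∈_ to _∈ₛ_)
open import Data.Fin.Subset.Properties using (∣p∣≤n; p⊂q⇒∣p∣<∣q∣)
open import Data.Fin.Subset.Induction using (⊂-wellFounded)
open import Data.Vec using (tabulate)
open import Data.Vec.Properties using (lookup∘tabulate; lookup⇒[]=; []=⇒lookup)
open import Data.Bool using (Bool; true; false; _∨_; _∧_)
import Data.Bool.Properties as Bool
open import Data.Maybe using (Maybe; just; nothing)
open import Data.Maybe.Properties using (just-injective)
import Data.Maybe.Properties as Maybe
open import Data.List using (List; []; _∷_; _++_)
open import Data.List.Membership.Propositional using () renaming (_∈_ to _∈ₗ_)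
open import Data.List.Membership.Propositional.Properties using (∈-++⁻)
open import Data.List.Relation.Unary.Linked using (Linked; [-]; _∷_)
open import Data.Empty using (⊥; ⊥-elim)
open import Data.Product using (∃; _×_; _,_; proj₁; proj₂)
open import Data.Sum using (_⊎_; inj₁; inj₂; [_,_])
open import Induction.WellFounded using (Acc; acc)
open import Relation.Binary.PropositionalEquality using (_≡_; _≢_; refl; sym; trans; subst; cong)
open import Relation.Binary.Construct.Closure.ReflexiveTransitive using (Star; ε; _◅_; _◅◅_)
open import Relation.Nullary using (¬_; Dec; yes; no; does)
import Relation.Nullary.Decidable as Dec
open import Relation.Nullary.Decidable using (_×-dec_; _⊎-dec_; dec-true)
open import Function.Bundles using (Equivalence)

module _ {n : ℕ} where

  ∈-∪ˡ : ∀ (U W : VSet n) {u} → u ∈ U → u ∈ U ∪ W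
  ∈-∪ˡ U W {u} u∈U rewrite u∈U = refl

  ∈-∪ʳ : ∀ (U W : VSet n) {u} → u ∈ W → u ∈ U ∪ W
  ∈-∪ʳ U W {u} u∈W with U u
  ... | true  = refl
  ... | false = u∈W

  ∈-∪⁻ : ∀ (U W : VSet n) {u} → u ∈ U ∪ W → u ∈ U ⊎ u ∈ W
  ∈-∪⁻ U W {u} u∈U∪W with U u
  ... | true  = inj₁ refl
  ... | false = inj₂ u∈U∪W

  ∈-⁅⁆ : ∀ (v : Fin n) → v ∈ ⁅ v ⁆
  ∈-⁅⁆ v with v Fin.≟ v
  ... | yes _   = refl
  ... | no v≢v = ⊥-elim (v≢v refl)

  ∈-⁅⁆⁻ : ∀ (v : Fin n) {u} → u ∈ ⁅ v ⁆ → u ≡ v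
  ∈-⁅⁆⁻ v {u} u∈⁅v⁆ with u Fin.≟ v
  ... | yes u≡v = u≡v
  ∈-⁅⁆⁻ v {u} () | no _

  ∈-∪⁅⁆⁻ : ∀ (U : VSet n) v {u} → u ∈ U ∪ ⁅ v ⁆ → u ∈ U ⊎ u ≡ v
  ∈-∪⁅⁆⁻ U v u∈ = Data.Sum.map₂ (∈-⁅⁆⁻ v) (∈-∪⁻ U ⁅ v ⁆ u∈)

  update-≡ : ∀ (σ : Strategy n) v w → update σ v w v ≡ just w
  update-≡ σ v w with v Fin.≟ v
  ... | yes _   = refl
  ... | no v≢v = ⊥-elim (v≢v refl)

  update-≢ : ∀ (σ : Strategy n) v w {u} → u ≢ v → update σ v w u ≡ σ u
  update-≢ σ v w {u} u≢v with u Fin.≟ v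
  ... | yes u≡v = ⊥-elim (u≢v u≡v)
  ... | no _    = refl

  extendStrat-just : ∀ (σ τ : Strategy n) {u w} → σ u ≡ just w → extendStrat σ τ u ≡ just w
  extendStrat-just σ τ {u} σu≡w with σ u
  extendStrat-just σ τ refl | just _ = refl

  extendStrat-nothing : ∀ (σ τ : Strategy n) {u} → σ u ≡ nothing → extendStrat σ τ u ≡ τ u
  extendStrat-nothing σ τ {u} σu≡∅ with σ u
  extendStrat-nothing σ τ refl | nothing = refl

  restrict-just⁻ : ∀ (σ : Strategy n) C {u w} → restrict σ C u ≡ just w → u ∈ C × σ u ≡ just w
  restrict-just⁻ σ C {u} eq with C u
  ... | true = refl , eq
  restrict-just⁻ σ C () | false

  restrict-just⁺ : ∀ (σ : Strategy n) C {u w} → u ∈ C → σ u ≡ just w → restrict σ C u ≡ just w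
  restrict-just⁺ σ C u∈C σu≡w rewrite u∈C = σu≡w

  size : VSet n → ℕ
  size S = ∣ tabulate S ∣

  ∈-tabulate⁺ : ∀ {S : VSet n} {v} → v ∈ S → v ∈ₛ tabulate S
  ∈-tabulate⁺ {S} {v} v∈S = lookup⇒[]= v (tabulate S) (trans (lookup∘tabulate S v) v∈S)

  ∈-tabulate⁻ : ∀ {S : VSet n} {v} → v ∈ₛ tabulate S → v ∈ S
  ∈-tabulate⁻ {S} {v} v∈S = trans (sym (lookup∘tabulate S v)) ([]=⇒lookup v∈S)

  ⊂-tabulate : ∀ {S S' : VSet n} → S ⊆ S' → ∀ v → v ∈ S' → S v ≡ false → tabulate S ⊂ tabulate S'
  ⊂-tabulate {S} S⊆S' v v∈S' v∉S =
    (λ x∈S → ∈-tabulate⁺ (S⊆S' _ (∈-tabulate⁻ x∈S))) , v , ∈-tabulate⁺ v∈S' ,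
    (λ v∈S → Bool.not-¬ v∉S (∈-tabulate⁻ v∈S))

module Reachability {n : ℕ} (R : Fin n → Fin n → Set) (R? : ∀ x y → Dec (R x y)) where

  hasPredecessorIn? : ∀ (S : VSet n) v → Dec (∃ λ w → w ∈ S × R w v)
  hasPredecessorIn? S v = Fin.any? λ w → (S w Bool.≟ true) ×-dec R? w v

  grow : VSet n → VSet n
  grow S v = S v ∨ does (hasPredecessorIn? S v)

  ⊆-grow : ∀ S → S ⊆ grow S
  ⊆-grow S v v∈S rewrite v∈S = refl

  grow-edge : ∀ S {w v} → w ∈ S → R w v → v ∈ grow S
  grow-edge S {w} {v} w∈S Rwv with S v
  ... | true = refl
  ... | false with hasPredecessorIn? S v
  ... | yes _   = refl
  ... | no none = ⊥-elim (none (w , w∈S , Rwv))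

  grow⁻ : ∀ S {v} → v ∈ grow S → v ∈ S ⊎ ∃ λ w → w ∈ S × R w v
  grow⁻ S {v} v∈ with S v
  ... | true = inj₁ refl
  ... | false with hasPredecessorIn? S v
  ... | yes pred = inj₂ pred
  grow⁻ S () | false | no _

  Closed : VSet n → Set
  Closed S = grow S ⊆ S

  closed-reach : ∀ {S} → Closed S → ∀ {u v} → u ∈ S → Star R u v → v ∈ S
  closed-reach c u∈S ε          = u∈S
  closed-reach {S} c u∈S (Ruw ◅ w→v) = closed-reach c (c _ (grow-edge S u∈S Ruw)) w→v

  Grows : VSet n → Set
  Grows S = ∃ λ v → v ∈ grow S × S v ≡ false

  grows? : ∀ S → Dec (Grows S)
  grows? S = Fin.any? λ v → (grow S v Bool.≟ true) ×-dec (S v Bool.≟ false)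

  closed-or-grows : ∀ S → Closed S ⊎ Grows S
  closed-or-grows S with grows? S
  ... | yes g    = inj₂ g
  ... | no stuck = inj₁ closed
    where
      closed : Closed S
      closed v v∈grow with S v Bool.≟ true
      ... | yes v∈S = v∈S
      ... | no v∉S  = ⊥-elim (stuck (v , v∈grow , Bool.¬-not v∉S))

  reachWithin : Fin n → ℕ → VSet n
  reachWithin u zero    = ⁅ u ⁆
  reachWithin u (suc k) = grow (reachWithin u k)

  reachWithin-sound : ∀ u k {v} → v ∈ reachWithin u k → Star R u v
  reachWithin-sound u zero {v} v∈ with refl ← ∈-⁅⁆⁻ u {v} v∈ = ε
  reachWithin-sound u (suc k) v∈ with grow⁻ (reachWithin u k) v∈
  ... | inj₁ v∈k            = reachWithin-sound u k v∈k
  ... | inj₂ (w , w∈k , Rwv) = reachWithin-sound u k w∈k ◅◅ (Rwv ◅ ε)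

  reachWithin-mono : ∀ u {j k} → j ≤ k → reachWithin u j ⊆ reachWithin u k
  reachWithin-mono u {k = zero}  z≤n v v∈ = v∈
  reachWithin-mono u {k = suc k} j≤1+k v v∈ with m≤n⇒m<n∨m≡n j≤1+k
  ... | inj₁ j<1+k = ⊆-grow _ v (reachWithin-mono u (≤-pred j<1+k) v v∈)
  ... | inj₂ refl  = v∈

  closes-or-large : ∀ u k → (∃ λ j → j ≤ k × Closed (reachWithin u j)) ⊎ k ≤ size (reachWithin u k)
  closes-or-large u zero = inj₂ z≤n
  closes-or-large u (suc k) with closes-or-large u k
  ... | inj₁ (j , j≤k , c) = inj₁ (j , m≤n⇒m≤1+n j≤k , c)
  ... | inj₂ k≤size with closed-or-grows (reachWithin u k)
  ... | inj₁ c = inj₁ (k , n≤1+n k , c)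
  ... | inj₂ (v , v∈ , v∉) =
    inj₂ (<-≤-trans (s≤s k≤size) (p⊂q⇒∣p∣<∣q∣ (⊂-tabulate (⊆-grow _) v v∈ v∉)))

  reach : Fin n → VSet n
  reach u = reachWithin u (suc n)

  reach-sound : ∀ u {v} → v ∈ reach u → Star R u v
  reach-sound u = reachWithin-sound u (suc n)

  -- a step that does not close adds a vertex, and there are only n of them
  reach-complete : ∀ u {v} → Star R u v → v ∈ reach u
  reach-complete u u→v with closes-or-large u (suc n)
  ... | inj₂ n<size = ⊥-elim (<-irrefl refl (<-≤-trans n<size (∣p∣≤n (tabulate (reach u)))))
  ... | inj₁ (j , j≤n , c) =
    reachWithin-mono u j≤n _ (closed-reach c (reachWithin-mono u {0} {j} z≤n u (∈-⁅⁆ u)) u→v)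

opp-≢ : ∀ α → α ≢ opp α
opp-≢ even ()
opp-≢ odd  ()

_≟ᴾ_ : (α β : Player) → Dec (α ≡ β)
even ≟ᴾ even = yes refl
even ≟ᴾ odd  = no λ ()
odd  ≟ᴾ even = no λ ()
odd  ≟ᴾ odd  = yes refl

same-or-opp : ∀ β α → β ≡ α ⊎ β ≡ opp α
same-or-opp even even = inj₁ refl
same-or-opp even odd  = inj₂ refl
same-or-opp odd  even = inj₂ refl
same-or-opp odd  odd  = inj₁ refl

closed-walk : ∀ {A : Set} {R : A → A → Set} {m x y} → Star R m x → R x y → Star R y m →
              ∃ λ z → R m z × Star R z m
closed-walk ε           Rxy y→m = _ , Rxy , y→m
closed-walk (Rmw ◅ w→x) Rxy y→m = _ , Rmw , (w→x ◅◅ (Rxy ◅ y→m))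

just-or-nothing : ∀ {A : Set} (m : Maybe A) → (∃ λ a → m ≡ just a) ⊎ m ≡ nothing
just-or-nothing (just a) = inj₁ (a , refl)
just-or-nothing nothing  = inj₂ refl

module _ {n : ℕ} (G : Game n) where
  open Game G
  open GameDefs G

  module _ (R : Fin n → Fin n → Set) (R? : ∀ x y → Dec (R x y)) (X : VSet n)
           (R-into : ∀ {x y} → R x y → y ∈ X) (R-total : ∀ x → x ∈ X → ∃ (R x)) where
    open Reachability R R?

    private
      star-into : ∀ {u v} → Star R u v → u ∈ X → v ∈ X
      star-into ε          u∈X = u∈X
      star-into (Ruw ◅ w→v) _  = star-into w→v (R-into Ruw)

      Escapes : Fin n → Set
      Escapes u = ∃ λ v → v ∈ reach u × reach v u ≡ false

      escapes? : ∀ u → Dec (Escapes u)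
      escapes? u = Fin.any? λ v → (reach u v Bool.≟ true) ×-dec (reach v u Bool.≟ false)

      reach-isBSCC : ∀ u → u ∈ X → ¬ Escapes u → NontrivialBSCC R X (reach u)
      reach-isBSCC u u∈X stays with R-total u u∈X
      ... | w , Ruw =
        (u , reach-complete u ε) ,
        (λ v v∈ → star-into (reach-sound u v∈) u∈X) ,
        (λ x y x∈ y∈ → reach-sound x (returns x∈) ◅◅ reach-sound u y∈) ,
        (λ { v (w , w∈ , w→v , _) → reach-complete u (reach-sound u w∈ ◅◅ w→v) }) ,
        (λ x y x∈ Rxy → reach-complete u (reach-sound u x∈ ◅◅ (Rxy ◅ ε))) ,
        (u , w , reach-complete u ε , reach-complete u (Ruw ◅ ε) , Ruw)
        where
          returns : ∀ {v} → v ∈ reach u → u ∈ reach v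
          returns {v} v∈ with reach v u Bool.≟ true
          ... | yes u∈ = u∈
          ... | no u∉  = ⊥-elim (stays (v , v∈ , Bool.¬-not u∉))

      bscc-below : ∀ u → u ∈ X → Acc _⊂_ (tabulate (reach u)) → ∃ (NontrivialBSCC R X)
      bscc-below u u∈X (acc smaller) with escapes? u
      ... | no stays = reach u , reach-isBSCC u u∈X stays
      ... | yes (v , v∈ , u∉) =
        bscc-below v (star-into (reach-sound u v∈) u∈X)
          (smaller (⊂-tabulate (λ w w∈ → reach-complete u (reach-sound u v∈ ◅◅ reach-sound v w∈))
                               u (reach-complete u ε) u∉))

    nontrivialBSCC-exists : ∀ u → u ∈ X → ∃ (NontrivialBSCC R X)
    nontrivialBSCC-exists u u∈X = bscc-below u u∈X (⊂-wellFounded _)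

  Below : ℕ → (Fin n → Fin n → Set) → Fin n → Fin n → Set
  Below k R x y = R x y × pr x ≤ k × pr y ≤ k

  -- a cycle is presented as a closed walk through its top-priority vertex m
  CyclesWonBy : (Fin n → Fin n → Set) → Player → Set
  CyclesWonBy R β = ∀ m x → Below (pr m) R m x → Star (Below (pr m) R) x m → parity (pr m) ≡ β

  map-Below : ∀ {k} {R S : Fin n → Fin n → Set} → (∀ {x y} → R x y → S x y) →
              ∀ {x y} → Star (Below k R) x y → Star (Below k S) x y
  map-Below f ε                   = ε
  map-Below f ((Rxy , bx , by) ◅ r) = (f Rxy , bx , by) ◅ map-Below f r

  -- the consequences of IsTangle that search uses; extracted tangles are only shown to have these
  record IsWeakTangle (t : TangleData n) : Set where
    field
      player      : Player
      strat-sound : ∀ u w → strat t u ≡ just w → u ∈ verts t × owner u ≡ player × w ∈ verts t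
      strat-total : ∀ u → u ∈ verts t → owner u ≡ player → ∃ λ w → strat t u ≡ just w
      top-parity  : ∀ q → MaxPr (verts t) q → parity q ≡ player
      cycles-won  : CyclesWonBy (HGraph fullSet player (strat t) (verts t)) player

  walkVertices : ∀ {R : Fin n → Fin n → Set} {x z} → Star R x z → List (Fin n)
  walkVertices ε                  = []
  walkVertices (_◅_ {i = x} _ r) = x ∷ walkVertices r

  walk-linked : ∀ {R S : Fin n → Fin n → Set} → (∀ {a b} → R a b → S a b) →
                ∀ {w x z} → S w x → (r : Star R x z) → Linked S (w ∷ walkVertices r ++ z ∷ [])
  walk-linked f Swx ε         = Swx ∷ [-]
  walk-linked f Swx (Rxy ◅ r) = Swx ∷ walk-linked f (f Rxy) r

  walkVertices-below : ∀ {k} {R : Fin n → Fin n → Set} {x z} (r : Star (Below k R) x z) →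
                       maxPrList (walkVertices r) ≤ k
  walkVertices-below ε                 = z≤n
  walkVertices-below ((_ , bx , _) ◅ r) = ⊔-lub bx (walkVertices-below r)

  isTangle⇒isWeakTangle : ∀ t → IsTangle t → IsWeakTangle t
  isTangle⇒isWeakTangle t (p , maxPr-p , σ-total , σ-dom , _ , cycles) = record
    { player      = parity p
    ; strat-sound = sound
    ; strat-total = λ u u∈ own → let (w , σu≡w , _) = σ-total u u∈ own in w , σu≡w
    ; top-parity  = λ q maxPr-q → cong parity (maxPr-unique maxPr-q maxPr-p)
    ; cycles-won  = λ m x (mx , _) x→m →
        subst (λ k → parity k ≡ parity p) (m≥n⇒m⊔n≡m (walkVertices-below x→m))
          (cycles (m ∷ walkVertices x→m) (walk-linked (λ (Rab , _) → toTangleGraph Rab) (toTangleGraph mx) x→m)) }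
    where
      U : VSet n
      U = verts t
      maxPr-unique : ∀ {q q'} → MaxPr U q → MaxPr U q' → q ≡ q'
      maxPr-unique ((v , v∈ , refl) , ≤q) ((v' , v'∈ , refl) , ≤q') = ≤-antisym (≤q' v v∈) (≤q v' v'∈)
      sound : ∀ u w → strat t u ≡ just w → u ∈ U × owner u ≡ parity p × w ∈ U
      sound u w σu≡w with σ-dom u w σu≡w
      ... | u∈ , own with σ-total u u∈ own
      ... | w' , σu≡w' , w'∈ , _ with refl ← just-injective (trans (sym σu≡w) σu≡w') = u∈ , own , w'∈
      toTangleGraph : ∀ {x y} → HGraph fullSet (parity p) (strat t) U x y → TangleGraph U (strat t) (parity p) x y
      toTangleGraph {x} (x∈ , y∈ , inj₁ (own , _ , _ , Exy)) = x∈ , y∈ , inj₂ (own , Exy)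
      toTangleGraph {x} (x∈ , y∈ , inj₂ (own , σx≡y)) with σ-total x x∈ own
      ... | _ , σx≡w , _ , Exw with refl ← just-injective (trans (sym σx≡y) σx≡w) =
        x∈ , y∈ , inj₁ (own , σx≡y , Exw)

  E'? : ∀ V' u w → Dec (E' V' u w)
  E'? V' u w = (V' u Bool.≟ true) ×-dec (V' w Bool.≟ true) ×-dec (edge u w Bool.≟ true)

  HGraph? : ∀ V' α σ X x y → Dec (HGraph V' α σ X x y)
  HGraph? V' α σ X x y =
    (X x Bool.≟ true) ×-dec (X y Bool.≟ true) ×-dec
    ((owner x ≟ᴾ opp α ×-dec E'? V' x y) ⊎-dec (owner x ≟ᴾ α ×-dec Maybe.≡-dec Fin._≟_ (σ x) (just y)))

  module Attractor (V' : VSet n) (Ts : List (TangleData n)) (α : Player) (p : ℕ)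
      (Ts-weak : ∀ t → t ∈ₗ Ts → IsWeakTangle t)
      (pr≤p : ∀ v → v ∈ V' → pr v ≤ p) (α≡p : α ≡ parity p) where

    Top : VSet n
    Top v = V' v ∧ does (pr v ℕ.≟ p)

    Top⁻ : ∀ {v} → v ∈ Top → v ∈ V' × pr v ≡ p
    Top⁻ {v} v∈ with V' v
    ... | true = refl , ≡ᵇ⇒≡ (pr v) p (Equivalence.from Bool.T-≡ v∈)

    Top⁺ : ∀ {v} → v ∈ V' → pr v ≡ p → v ∈ Top
    Top⁺ {v} v∈ pr≡p rewrite v∈ = dec-true (pr v ℕ.≟ p) pr≡p

    Graph : VSet n → Strategy n → Fin n → Fin n → Set
    Graph Z σ = HGraph V' α σ Z

    record Invariant (Z : VSet n) (σ : Strategy n) : Set where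
      field
        Top⊆Z      : Top ⊆ Z
        Z⊆V'       : Z ⊆ V'
        σ-sound    : ∀ u w → σ u ≡ just w → u ∈ Z × owner u ≡ α × w ∈ Z
        opp-closed : ∀ u → u ∈ Z → u ∉ Top → owner u ≡ opp α → ∀ w → E' V' u w → w ∈ Z
        σ-total    : ∀ u → u ∈ Z → u ∉ Top → owner u ≡ α → ∃ λ w → σ u ≡ just w
        cycles-won : CyclesWonBy (Graph Z σ) α

    visits-Top : ∀ {m w} → m ∈ V' → w ∈ Top → pr w ≤ pr m → parity (pr m) ≡ α
    visits-Top {m} m∈ w∈ prw≤prm =
      trans (cong parity (≤-antisym (pr≤p m m∈) (subst (_≤ pr m) (proj₂ (Top⁻ w∈)) prw≤prm))) (sym α≡p)

    -- Edges leaving old vertices outside Top are old edges, so a cycle avoiding Top lies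
    -- entirely inside Z or entirely outside Z; a cycle meeting Top has top priority p.
    module Extension {Z σ Z' σ'} (I : Invariant Z σ) (Z'⊆V' : Z' ⊆ V')
        (σ-kept : ∀ {x y} → x ∈ Z → x ∉ Top → σ' x ≡ just y → σ x ≡ just y)
        (new-cycles-won : CyclesWonBy (λ x y → Graph Z' σ' x y × x ∉ Z × y ∉ Z) α) where
      open Invariant I

      private
        New : Fin n → Fin n → Set
        New x y = Graph Z' σ' x y × x ∉ Z × y ∉ Z

        VisitsTop : ℕ → Set
        VisitsTop k = ∃ λ w → w ∈ Top × pr w ≤ k

        old-edge : ∀ {x y} → x ∈ Z → x ∉ Top → Graph Z' σ' x y → Graph Z σ x y
        old-edge x∈Z x∉Top (_ , _ , inj₁ (o , Exy)) = x∈Z , opp-closed _ x∈Z x∉Top o _ Exy , inj₁ (o , Exy)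
        old-edge x∈Z x∉Top (_ , _ , inj₂ (o , σ'x≡y)) =
          let σx≡y = σ-kept x∈Z x∉Top σ'x≡y in x∈Z , proj₂ (proj₂ (σ-sound _ _ σx≡y)) , inj₂ (o , σx≡y)

        stays-in-Z : ∀ {k y z} → Star (Below k (Graph Z σ)) y z → y ∈ Z → z ∈ Z
        stays-in-Z ε                    y∈Z = y∈Z
        stays-in-Z ((Gyw , _) ◅ w→z) _ = stays-in-Z w→z (proj₁ (proj₂ Gyw))

        from-Z : ∀ {k x z} → Star (Below k (Graph Z' σ')) x z → x ∈ Z →
                 VisitsTop k ⊎ Star (Below k (Graph Z σ)) x z
        from-Z ε _ = inj₂ ε
        from-Z (_◅_ {i = x} {j = y} (Gxy , bx , by) y→z) x∈Z with Top x Bool.≟ true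
        ... | yes x∈Top = inj₁ (x , x∈Top , bx)
        ... | no x∉Top  = Data.Sum.map₂ ((old , bx , by) ◅_) (from-Z y→z (proj₁ (proj₂ old)))
          where
            old : Graph Z σ x y
            old = old-edge x∈Z x∉Top Gxy

        outside-Z : ∀ {k x z} → Star (Below k (Graph Z' σ')) x z → x ∉ Z → z ∉ Z →
                    VisitsTop k ⊎ Star (Below k New) x z
        outside-Z ε _ _ = inj₂ ε
        outside-Z (_◅_ {j = y} (Gxy , bx , by) y→z) x∉Z z∉Z with Z y Bool.≟ true
        ... | yes y∈Z = Data.Sum.map₂ (λ old → ⊥-elim (z∉Z (stays-in-Z old y∈Z))) (from-Z y→z y∈Z)
        ... | no y∉Z  = Data.Sum.map₂ (((Gxy , x∉Z , y∉Z) , bx , by) ◅_) (outside-Z y→z y∉Z z∉Z)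

      extended-cycles-won : CyclesWonBy (Graph Z' σ') α
      extended-cycles-won m x (Gmx , bm , bx) x→m with Z'⊆V' m (proj₁ Gmx) | Z m Bool.≟ true
      ... | m∈V' | yes m∈Z with Top m Bool.≟ true
      ... | yes m∈Top = visits-Top m∈V' m∈Top ≤-refl
      ... | no m∉Top with old-edge m∈Z m∉Top Gmx
      ... | old with from-Z x→m (proj₁ (proj₂ old))
      ... | inj₁ (w , w∈Top , prw≤) = visits-Top m∈V' w∈Top prw≤
      ... | inj₂ old-walk = cycles-won m x (old , bm , bx) old-walk
      extended-cycles-won m x (Gmx , bm , bx) x→m | m∈V' | no m∉Z with Z x Bool.≟ true
      ... | yes x∈Z = [ (λ (w , w∈Top , prw≤) → visits-Top m∈V' w∈Top prw≤)
                      , (λ old-walk → ⊥-elim (m∉Z (stays-in-Z old-walk x∈Z))) ] (from-Z x→m x∈Z)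
      ... | no x∉Z = [ (λ (w , w∈Top , prw≤) → visits-Top m∈V' w∈Top prw≤)
                     , new-cycles-won m x ((Gmx , m∉Z , x∉Z) , bm , bx) ] (outside-Z x→m x∉Z m∉Z)

    private
      no-new-edges : ∀ (Z : VSet n) {Z' σ'} → (∀ {x y} → Graph Z' σ' x y → x ∉ Z → y ∉ Z → ⊥) →
                     CyclesWonBy (λ x y → Graph Z' σ' x y × x ∉ Z × y ∉ Z) α
      no-new-edges Z none m x ((Gmx , m∉ , x∉) , _) _ = ⊥-elim (none Gmx m∉ x∉)

      ∪⁅⁆⊆V' : ∀ {Z v} → Z ⊆ V' → v ∈ V' → Z ∪ ⁅ v ⁆ ⊆ V'
      ∪⁅⁆⊆V' {Z} {v} Z⊆V' v∈V' u u∈ = [ Z⊆V' u , (λ { refl → v∈V' }) ] (∈-∪⁅⁆⁻ Z v u∈)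

      the-new-vertex : ∀ (Z : VSet n) v x → x ∈ Z ∪ ⁅ v ⁆ → x ∉ Z → x ≡ v
      the-new-vertex Z v x x∈ x∉Z = [ (λ x∈Z → ⊥-elim (x∉Z x∈Z)) , (λ x≡v → x≡v) ] (∈-∪⁅⁆⁻ Z v x∈)

    attrOwn-preserves : ∀ {Z σ} → Invariant Z σ → ∀ {v w} → v ∈ V' → v ∉ Z → owner v ≡ α → w ∈ Z →
                        Invariant (Z ∪ ⁅ v ⁆) (update σ v w)
    attrOwn-preserves {Z} {σ} I {v} {w} v∈V' v∉Z own w∈Z = record
      { Top⊆Z      = λ u u∈ → ∈-∪ˡ Z ⁅ v ⁆ (Top⊆Z u u∈)
      ; Z⊆V'       = Z'⊆V'
      ; σ-sound    = sound
      ; opp-closed = closed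
      ; σ-total    = total
      ; cycles-won = Extension.extended-cycles-won I Z'⊆V'
                       (λ x∈Z _ → trans (sym (update-≢ σ v w (≢v x∈Z)))) (no-new-edges Z no-loop) }
      where
        open Invariant I
        Z' : VSet n
        Z' = Z ∪ ⁅ v ⁆
        Z'⊆V' : Z' ⊆ V'
        Z'⊆V' = ∪⁅⁆⊆V' Z⊆V' v∈V'
        ≢v : ∀ {u} → u ∈ Z → u ≢ v
        ≢v u∈Z refl = v∉Z u∈Z
        sound : ∀ u w' → update σ v w u ≡ just w' → u ∈ Z' × owner u ≡ α × w' ∈ Z'
        sound u w' σ'u with Dec.toSum (u Fin.≟ v)
        ... | inj₁ refl = ∈-∪ʳ Z ⁅ v ⁆ (∈-⁅⁆ v) , own ,
              ∈-∪ˡ Z ⁅ v ⁆ (subst (_∈ Z) (just-injective (trans (sym (update-≡ σ v w)) σ'u)) w∈Z)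
        ... | inj₂ u≢v =
              let (u∈Z , o , w'∈Z) = σ-sound u w' (trans (sym (update-≢ σ v w u≢v)) σ'u)
              in ∈-∪ˡ Z ⁅ v ⁆ u∈Z , o , ∈-∪ˡ Z ⁅ v ⁆ w'∈Z
        closed : ∀ u → u ∈ Z' → u ∉ Top → owner u ≡ opp α → ∀ w' → E' V' u w' → w' ∈ Z'
        closed u u∈ u∉Top o w' Euw' with ∈-∪⁅⁆⁻ Z v u∈
        ... | inj₁ u∈Z = ∈-∪ˡ Z ⁅ v ⁆ (opp-closed u u∈Z u∉Top o w' Euw')
        ... | inj₂ refl = ⊥-elim (opp-≢ α (trans (sym own) o))
        total : ∀ u → u ∈ Z' → u ∉ Top → owner u ≡ α → ∃ λ w' → update σ v w u ≡ just w'
        total u u∈ u∉Top o with ∈-∪⁅⁆⁻ Z v u∈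
        ... | inj₂ refl = w , update-≡ σ v w
        ... | inj₁ u∈Z = let (w' , σu) = σ-total u u∈Z u∉Top o in w' , trans (update-≢ σ v w (≢v u∈Z)) σu
        no-loop : ∀ {x y} → Graph Z' (update σ v w) x y → x ∉ Z → y ∉ Z → ⊥
        no-loop {x} (x∈ , _ , inj₁ (o , _)) x∉Z _ =
          opp-≢ α (trans (sym own) (subst (λ u → owner u ≡ opp α) (the-new-vertex Z v x x∈ x∉Z) o))
        no-loop {x} {y} (x∈ , _ , inj₂ (_ , σ'x≡y)) x∉Z y∉Z =
          y∉Z (subst (_∈ Z) (just-injective (trans (sym (update-≡ σ v w))
                (subst (λ u → update σ v w u ≡ just y) (the-new-vertex Z v x x∈ x∉Z) σ'x≡y))) w∈Z)

    attrOpp-preserves : ∀ {Z σ} → Invariant Z σ → ∀ {v} → v ∈ V' → v ∉ Z → owner v ≡ opp α →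
                        (∀ w → E' V' v w → w ∈ Z) → Invariant (Z ∪ ⁅ v ⁆) σ
    attrOpp-preserves {Z} {σ} I {v} v∈V' v∉Z own succ⊆Z = record
      { Top⊆Z      = λ u u∈ → ∈-∪ˡ Z ⁅ v ⁆ (Top⊆Z u u∈)
      ; Z⊆V'       = Z'⊆V'
      ; σ-sound    = λ u w σu → let (u∈Z , o , w∈Z) = σ-sound u w σu
                                in ∈-∪ˡ Z ⁅ v ⁆ u∈Z , o , ∈-∪ˡ Z ⁅ v ⁆ w∈Z
      ; opp-closed = closed
      ; σ-total    = total
      ; cycles-won = Extension.extended-cycles-won I Z'⊆V' (λ _ _ σx → σx) (no-new-edges Z no-loop) }
      where
        open Invariant I
        Z' : VSet n
        Z' = Z ∪ ⁅ v ⁆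
        Z'⊆V' : Z' ⊆ V'
        Z'⊆V' = ∪⁅⁆⊆V' Z⊆V' v∈V'
        closed : ∀ u → u ∈ Z' → u ∉ Top → owner u ≡ opp α → ∀ w → E' V' u w → w ∈ Z'
        closed u u∈ u∉Top o w Euw with ∈-∪⁅⁆⁻ Z v u∈
        ... | inj₁ u∈Z = ∈-∪ˡ Z ⁅ v ⁆ (opp-closed u u∈Z u∉Top o w Euw)
        ... | inj₂ refl = ∈-∪ˡ Z ⁅ v ⁆ (succ⊆Z w Euw)
        total : ∀ u → u ∈ Z' → u ∉ Top → owner u ≡ α → ∃ λ w → σ u ≡ just w
        total u u∈ u∉Top o with ∈-∪⁅⁆⁻ Z v u∈
        ... | inj₁ u∈Z = σ-total u u∈Z u∉Top o
        ... | inj₂ refl = ⊥-elim (opp-≢ α (trans (sym o) own))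
        no-loop : ∀ {x y} → Graph Z' σ x y → x ∉ Z → y ∉ Z → ⊥
        no-loop {x} {y} (x∈ , _ , inj₁ (_ , Exy)) x∉Z y∉Z =
          y∉Z (succ⊆Z y (subst (λ u → E' V' u y) (the-new-vertex Z v x x∈ x∉Z) Exy))
        no-loop {x} (x∈ , _ , inj₂ (o , _)) x∉Z _ =
          opp-≢ α (trans (sym (subst (λ u → owner u ≡ α) (the-new-vertex Z v x x∈ x∉Z) o)) own)

    attrTop-preserves : ∀ {Z σ} → Invariant Z σ → ∀ {v w} → v ∈ Top → owner v ≡ α → w ∈ Z →
                        Invariant Z (update σ v w)
    attrTop-preserves {Z} {σ} I {v} {w} v∈Top own w∈Z = record
      { Top⊆Z      = Top⊆Z
      ; Z⊆V'       = Z⊆V'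
      ; σ-sound    = sound
      ; opp-closed = opp-closed
      ; σ-total    = λ u u∈Z u∉Top o → let (w' , σu) = σ-total u u∈Z u∉Top o
                                       in w' , trans (update-≢ σ v w (≢v u∉Top)) σu
      ; cycles-won = Extension.extended-cycles-won I Z⊆V'
                       (λ _ x∉Top → trans (sym (update-≢ σ v w (≢v x∉Top))))
                       (no-new-edges Z λ G x∉Z _ → x∉Z (proj₁ G)) }
      where
        open Invariant I
        ≢v : ∀ {u} → u ∉ Top → u ≢ v
        ≢v u∉Top refl = u∉Top v∈Top
        sound : ∀ u w' → update σ v w u ≡ just w' → u ∈ Z × owner u ≡ α × w' ∈ Z
        sound u w' σ'u with Dec.toSum (u Fin.≟ v)
        ... | inj₁ refl =
          Top⊆Z v v∈Top , own , subst (_∈ Z) (just-injective (trans (sym (update-≡ σ v w)) σ'u)) w∈Z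
        ... | inj₂ u≢v = σ-sound u w' (trans (sym (update-≢ σ v w u≢v)) σ'u)

    attrTangle-preserves : ∀ {Z σ} → Invariant Z σ → ∀ {t} → t ∈ₗ Ts → verts t ⊆ V' →
                           (∃ λ q → MaxPr (verts t) q × parity q ≡ α) → (∀ v → InET V' t α v → v ∈ Z) →
                           Invariant (Z ∪ verts t) (extendStrat σ (strat t))
    attrTangle-preserves {Z} {σ} I {t} t∈Ts t⊆V' (q , maxPr-q , q≡α) ET⊆Z = record
      { Top⊆Z      = λ u u∈ → ∈-∪ˡ Z U (Top⊆Z u u∈)
      ; Z⊆V'       = Z'⊆V'
      ; σ-sound    = sound
      ; opp-closed = closed
      ; σ-total    = total
      ; cycles-won = Extension.extended-cycles-won I Z'⊆V' kept new-cycles-won }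
      where
        open Invariant I
        module W = IsWeakTangle (Ts-weak t t∈Ts)
        U Z' : VSet n
        U  = verts t
        Z' = Z ∪ U
        σ' : Strategy n
        σ' = extendStrat σ (strat t)

        player≡α : W.player ≡ α
        player≡α = trans (sym (W.top-parity q maxPr-q)) q≡α

        Z'⊆V' : Z' ⊆ V'
        Z'⊆V' u u∈ = [ Z⊆V' u , t⊆V' u ] (∈-∪⁻ Z U u∈)

        in-U : ∀ {x} → x ∈ Z' → x ∉ Z → x ∈ U
        in-U x∈ x∉Z = [ (λ x∈Z → ⊥-elim (x∉Z x∈Z)) , (λ x∈U → x∈U) ] (∈-∪⁻ Z U x∈)

        sound : ∀ u w → σ' u ≡ just w → u ∈ Z' × owner u ≡ α × w ∈ Z'
        sound u w σ'u with just-or-nothing (σ u)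
        ... | inj₁ (w' , σu) with refl ← just-injective (trans (sym (extendStrat-just σ (strat t) σu)) σ'u) =
          let (u∈Z , o , w∈Z) = σ-sound u w' σu in ∈-∪ˡ Z U u∈Z , o , ∈-∪ˡ Z U w∈Z
        ... | inj₂ σu =
          let (u∈U , o , w∈U) = W.strat-sound u w (trans (sym (extendStrat-nothing σ (strat t) σu)) σ'u)
          in ∈-∪ʳ Z U u∈U , trans o player≡α , ∈-∪ʳ Z U w∈U

        closed : ∀ u → u ∈ Z' → u ∉ Top → owner u ≡ opp α → ∀ w → E' V' u w → w ∈ Z'
        closed u u∈ u∉Top o w Euw with ∈-∪⁻ Z U u∈ | U w Bool.≟ true
        ... | inj₁ u∈Z | _       = ∈-∪ˡ Z U (opp-closed u u∈Z u∉Top o w Euw)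
        ... | inj₂ _   | yes w∈U = ∈-∪ʳ Z U w∈U
        ... | inj₂ u∈U | no w∉U  = ∈-∪ˡ Z U (ET⊆Z w (proj₁ (proj₂ Euw) , w∉U , u , u∈U , o , Euw))

        σ-undefined-outside-Z : ∀ {u} → u ∈ Z → u ∉ Top → σ u ≡ nothing → strat t u ≡ nothing
        σ-undefined-outside-Z {u} u∈Z u∉Top σu with just-or-nothing (strat t u)
        ... | inj₂ τu = τu
        ... | inj₁ (w , τu) with σ-total u u∈Z u∉Top (trans (proj₁ (proj₂ (W.strat-sound u w τu))) player≡α)
        ... | _ , σu≡w with () ← trans (sym σu) σu≡w

        total : ∀ u → u ∈ Z' → u ∉ Top → owner u ≡ α → ∃ λ w → σ' u ≡ just w
        total u u∈ u∉Top o with just-or-nothing (σ u)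
        ... | inj₁ (w , σu) = w , extendStrat-just σ (strat t) σu
        ... | inj₂ σu with ∈-∪⁻ Z U u∈
        ... | inj₁ u∈Z with () ← trans (sym (proj₂ (σ-total u u∈Z u∉Top o))) σu
        ... | inj₂ u∈U = let (w , τu) = W.strat-total u u∈U (trans o (sym player≡α))
                         in w , trans (extendStrat-nothing σ (strat t) σu) τu

        kept : ∀ {x y} → x ∈ Z → x ∉ Top → σ' x ≡ just y → σ x ≡ just y
        kept {x} x∈Z x∉Top σ'x with just-or-nothing (σ x)
        ... | inj₁ (w , σx) = trans σx (trans (sym (extendStrat-just σ (strat t) σx)) σ'x)
        ... | inj₂ σx with () ← trans (sym (σ-undefined-outside-Z x∈Z x∉Top σx))
                                      (trans (sym (extendStrat-nothing σ (strat t) σx)) σ'x)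

        tangle-edge : ∀ {x y} → Graph Z' σ' x y × x ∉ Z × y ∉ Z → HGraph fullSet W.player (strat t) U x y
        tangle-edge ((x∈ , y∈ , inj₁ (o , Exy)) , x∉Z , y∉Z) =
          in-U x∈ x∉Z , in-U y∈ y∉Z ,
          inj₁ (subst (λ β → _ ≡ opp β) (sym player≡α) o , refl , refl , proj₂ (proj₂ Exy))
        tangle-edge {x} ((x∈ , y∈ , inj₂ (o , σ'x)) , x∉Z , y∉Z) with just-or-nothing (σ x)
        ... | inj₁ (_ , σx) = ⊥-elim (x∉Z (proj₁ (σ-sound x _ σx)))
        ... | inj₂ σx = in-U x∈ x∉Z , in-U y∈ y∉Z ,
                        inj₂ (trans o (sym player≡α) , trans (sym (extendStrat-nothing σ (strat t) σx)) σ'x)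

        new-cycles-won : CyclesWonBy (λ x y → Graph Z' σ' x y × x ∉ Z × y ∉ Z) α
        new-cycles-won m x (new , bm , bx) x→m =
          trans (W.cycles-won m x (tangle-edge new , bm , bx) (map-Below tangle-edge x→m)) player≡α

    initial-invariant : Invariant Top (λ _ → nothing)
    initial-invariant = record
      { Top⊆Z      = λ _ v∈ → v∈
      ; Z⊆V'       = λ _ v∈ → proj₁ (Top⁻ v∈)
      ; σ-sound    = λ _ _ ()
      ; opp-closed = λ _ u∈ u∉ → ⊥-elim (u∉ u∈)
      ; σ-total    = λ _ u∈ u∉ → ⊥-elim (u∉ u∈)
      ; cycles-won = λ _ _ (Gmx , _) _ → trans (cong parity (proj₂ (Top⁻ (proj₁ Gmx)))) (sym α≡p) }

    invariant-step : ∀ {Z σ Z' σ'} → Invariant Z σ → AttrStep V' Ts α Top ⟨ Z , σ ⟩ ⟨ Z' , σ' ⟩ →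
                     Invariant Z' σ'
    invariant-step I (attrOwn _ _ v∈ v∉ o _ w∈)             = attrOwn-preserves I v∈ v∉ o w∈
    invariant-step I (attrOpp _ v∈ v∉ o succ⊆)              = attrOpp-preserves I v∈ v∉ o succ⊆
    invariant-step I (attrTop _ _ v∈ o _ _ w∈)               = attrTop-preserves I v∈ o w∈
    invariant-step I (attrTangle _ t∈ t⊆ maxPr _ ET⊆Z _) = attrTangle-preserves I t∈ t⊆ maxPr ET⊆Z

    invariant-run : ∀ {s s'} → Invariant (AttrState.Zset s) (AttrState.σset s) →
                    Star (AttrStep V' Ts α Top) s s' → Invariant (AttrState.Zset s') (AttrState.σset s')
    invariant-run I ε = I
    invariant-run {⟨ _ , _ ⟩} I (_◅_ {j = ⟨ _ , _ ⟩} step steps) = invariant-run (invariant-step I step) steps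

    attractor-invariant : ∀ {Z σ} → TAttrResult V' Ts α Top Z σ → Invariant Z σ
    attractor-invariant (run , _) = invariant-run initial-invariant run

    module Extracted {Z σ X} (I : Invariant Z σ) (greatest : IsGreatestX V' α Z σ X) {a : TangleData n}
        (bscc : NontrivialBSCC (HGraph V' α σ X) X (verts a))
        (strat-a : ∀ v → strat a v ≡ restrict σ (verts a) v) where
      open Invariant I

      private
        C : VSet n
        C = verts a

        H : Fin n → Fin n → Set
        H = HGraph V' α σ X

        C⊆X : C ⊆ X
        C⊆X = proj₁ (proj₂ bscc)

        C-connected : ∀ u v → u ∈ C → v ∈ C → Star H u v
        C-connected = proj₁ (proj₂ (proj₂ bscc))

        C-bottom : ∀ u v → u ∈ C → H u v → v ∈ C
        C-bottom = proj₁ (proj₂ (proj₂ (proj₂ (proj₂ bscc))))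

        σ-edge-in-C : ∀ {u w} → u ∈ C → σ u ≡ just w → owner u ≡ α → w ∈ C
        σ-edge-in-C {u} u∈C σu o with proj₂ (proj₁ greatest u (C⊆X u u∈C))
        ... | inj₁ (o' , _) = ⊥-elim (opp-≢ α (trans (sym o) o'))
        ... | inj₂ (_ , _ , σu' , w'∈X) with refl ← just-injective (trans (sym σu') σu) =
          C-bottom u _ u∈C (C⊆X u u∈C , w'∈X , inj₂ (o , σu))

        C⊆Z : ∀ {v} → v ∈ C → v ∈ Z
        C⊆Z {v} v∈C = proj₁ (proj₁ greatest v (C⊆X v v∈C))

        to-attractor-edge : ∀ {x y} → HGraph fullSet α (strat a) C x y → Graph Z σ x y
        to-attractor-edge {x} {y} (x∈C , y∈C , inj₁ (o , _ , _ , Exy)) =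
          C⊆Z x∈C , C⊆Z y∈C , inj₁ (o , Z⊆V' x (C⊆Z x∈C) , Z⊆V' y (C⊆Z y∈C) , Exy)
        to-attractor-edge {x} (x∈C , y∈C , inj₂ (o , τx)) =
          C⊆Z x∈C , C⊆Z y∈C , inj₂ (o , proj₂ (restrict-just⁻ σ C (trans (sym (strat-a x)) τx)))

        from-H-edge : ∀ {x y} → H x y → x ∈ C → HGraph fullSet α (strat a) C x y
        from-H-edge {x} {y} h@(_ , _ , inj₁ (o , Exy)) x∈C =
          x∈C , C-bottom x y x∈C h , inj₁ (o , refl , refl , proj₂ (proj₂ Exy))
        from-H-edge {x} {y} h@(_ , _ , inj₂ (o , σx)) x∈C =
          x∈C , C-bottom x y x∈C h , inj₂ (o , trans (strat-a x) (restrict-just⁺ σ C x∈C σx))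

        from-H-walk : ∀ {k u v} → (∀ w → w ∈ C → pr w ≤ k) → Star H u v → u ∈ C →
                      Star (Below k (HGraph fullSet α (strat a) C)) u v
        from-H-walk bound ε _ = ε
        from-H-walk bound (_◅_ {i = u} {j = w} h w→v) u∈C =
          (from-H-edge h u∈C , bound u u∈C , bound w w∈C) ◅ from-H-walk bound w→v w∈C
          where
            w∈C : w ∈ C
            w∈C = C-bottom u w u∈C h

        strat-cycles-won : CyclesWonBy (HGraph fullSet α (strat a) C) α
        strat-cycles-won m x (Tmx , bm , bx) x→m =
          cycles-won m x (to-attractor-edge Tmx , bm , bx) (map-Below to-attractor-edge x→m)

      isWeakTangle : IsWeakTangle a
      isWeakTangle = record
        { player      = α
        ; strat-sound = sound
        ; strat-total = total
        ; top-parity  = top-parity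
        ; cycles-won  = strat-cycles-won }
        where
          sound : ∀ u w → strat a u ≡ just w → u ∈ C × owner u ≡ α × w ∈ C
          sound u w τu with restrict-just⁻ σ C (trans (sym (strat-a u)) τu)
          ... | u∈C , σu = let o = proj₁ (proj₂ (σ-sound u w σu)) in u∈C , o , σ-edge-in-C u∈C σu o

          total : ∀ u → u ∈ C → owner u ≡ α → ∃ λ w → strat a u ≡ just w
          total u u∈C o with proj₂ (proj₁ greatest u (C⊆X u u∈C))
          ... | inj₁ (o' , _)            = ⊥-elim (opp-≢ α (trans (sym o) o'))
          ... | inj₂ (_ , w , σu , _) = w , trans (strat-a u) (restrict-just⁺ σ C u∈C σu)

          -- close the nontrivial edge of C into a cycle through a top-priority vertex m
          top-parity : ∀ q → MaxPr C q → parity q ≡ α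
          top-parity q ((m , m∈C , refl) , bound) with proj₂ (proj₂ (proj₂ (proj₂ (proj₂ bscc))))
          ... | x , y , x∈C , y∈C , Hxy with closed-walk (C-connected m x m∈C x∈C) Hxy (C-connected y m y∈C m∈C)
          ... | z , Hmz , z→m =
            strat-cycles-won m z (from-H-edge Hmz m∈C , bound m m∈C , bound z (C-bottom m z m∈C Hmz))
                                 (from-H-walk bound z→m (C-bottom m z m∈C Hmz))

    module Lowest {Z σ} (result : TAttrResult V' Ts α Top Z σ) (V'⊆Z : V' ⊆ Z)
        (V'-total : ∀ v → v ∈ V' → ∃ (E' V' v)) where
      open Invariant (attractor-invariant result)

      σ-total-on-Z : ∀ u → u ∈ Z → owner u ≡ α → ∃ λ w → σ u ≡ just w × w ∈ Z
      σ-total-on-Z u u∈Z o with just-or-nothing (σ u) | Top u Bool.≟ true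
      ... | inj₁ (w , σu) | _ = w , σu , proj₂ (proj₂ (σ-sound u w σu))
      ... | inj₂ σu | yes u∈Top =
        let (w , Euw) = V'-total u (Z⊆V' u u∈Z)
        in ⊥-elim (proj₂ result _ (attrTop u w u∈Top o σu Euw (V'⊆Z w (proj₁ (proj₂ Euw)))))
      ... | inj₂ σu | no u∉Top with () ← trans (sym σu) (proj₂ (σ-total u u∈Z u∉Top o))

      Z-postfixed : ∀ v → v ∈ Z → XOp V' α Z σ Z v
      Z-postfixed v v∈Z with same-or-opp (owner v) α
      ... | inj₁ o = v∈Z , inj₂ (o , σ-total-on-Z v v∈Z o)
      ... | inj₂ o = v∈Z , inj₁ (o , λ w Evw → V'⊆Z w (proj₁ (proj₂ Evw)))

      Z⊆greatestX : ∀ {X} → IsGreatestX V' α Z σ X → Z ⊆ X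
      Z⊆greatestX (_ , _ , greatest) = greatest Z Z-postfixed

  record SearchInvariant (s : SearchState) : Set where
    field
      T-weak     : ∀ t → t ∈ₗ Tcur s → IsWeakTangle t
      Y-weak     : ∀ t → t ∈ₗ Ycur s → IsWeakTangle t
      free-total : ∀ v → v ∈ free (reg s) → ∃ (E' (free (reg s)) v)
  open SearchInvariant

  free-setRegion⁻ : ∀ r (Z : VSet n) p {v} → v ∈ free (setRegion r Z p) → v ∈ free r × v ∉ Z
  free-setRegion⁻ r Z p {v} v∈ with Z v
  ... | false = v∈ , λ ()

  free-setRegion⁺ : ∀ r (Z : VSet n) p {v} → v ∈ free r → v ∉ Z → v ∈ free (setRegion r Z p)
  free-setRegion⁺ r Z p v∈ v∉Z rewrite Bool.¬-not v∉Z = v∈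

  region-extracted-weak : ∀ {s p α Z σ A} → SearchInvariant s → RegionComputation s p α Z σ A →
                          ∀ a → a ∈ₗ A → IsWeakTangle a
  region-extracted-weak {s} {p} {α} I (_ , (_ , pr≤p) , α≡p , attr , _ , greatestX , sound , _) a a∈A =
    Extracted.isWeakTangle (attractor-invariant attr) greatestX (proj₁ (sound a a∈A)) (proj₂ (sound a a∈A))
    where open Attractor (free (reg s)) (Tcur s) α p (T-weak I) pr≤p α≡p

  -- the attractor is maximal, so the remaining subgame keeps a move from every vertex
  region-remaining-total : ∀ {s p α Z σ A} → SearchInvariant s → RegionComputation s p α Z σ A →
                           ∀ v → v ∈ free (setRegion (reg s) Z p) → ∃ (E' (free (setRegion (reg s) Z p)) v)
  region-remaining-total {s} {p} {α} {Z} I (_ , _ , _ , (_ , maximal) , _) v v∈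
    with free-setRegion⁻ (reg s) Z p v∈ | same-or-opp (owner v) α
  ... | v∈V' , v∉Z | inj₁ o with free-total I v v∈V'
  ... | w , Evw with Z w Bool.≟ true
  ... | yes w∈Z = ⊥-elim (maximal _ (attrOwn v w v∈V' v∉Z o Evw w∈Z))
  ... | no w∉Z  = w , v∈ , free-setRegion⁺ (reg s) Z p (proj₁ (proj₂ Evw)) w∉Z , proj₂ (proj₂ Evw)
  region-remaining-total {s} {p} {α} {Z} I (_ , _ , _ , (_ , maximal) , _) v v∈
      | v∈V' , v∉Z | inj₂ o with Fin.any? (λ w → E'? (free (reg s)) v w ×-dec (Z w Bool.≟ false))
  ... | yes (w , Evw , w∉Z) =
    w , v∈ , free-setRegion⁺ (reg s) Z p (proj₁ (proj₂ Evw)) (Bool.not-¬ w∉Z) , proj₂ (proj₂ Evw)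
  ... | no none = ⊥-elim (maximal _ (attrOpp v v∈V' v∉Z o succ⊆Z))
    where
      succ⊆Z : ∀ w → E' (free (reg s)) v w → w ∈ Z
      succ⊆Z w Evw with Z w Bool.≟ true
      ... | yes w∈Z = w∈Z
      ... | no w∉Z  = ⊥-elim (none (w , Evw , Bool.¬-not w∉Z))

  full-total : ∀ v → ∃ (E' (free (λ _ → nothing)) v)
  full-total v = proj₁ (leftTotal v) , refl , refl , proj₂ (leftTotal v)

  initial-search-invariant : ∀ T₀ → (∀ t → t ∈ₗ T₀ → IsTangle t) → SearchInvariant (initState T₀)
  initial-search-invariant T₀ T₀-tangles = record
    { T-weak     = λ t t∈ → isTangle⇒isWeakTangle t (T₀-tangles t t∈)
    ; Y-weak     = λ _ ()
    ; free-total = λ v _ → full-total v }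

  search-step : ∀ {s s'} → SearchStep s s' → SearchInvariant s → SearchInvariant s'
  search-step (region {s} rc _) I = record
    { T-weak     = T-weak I
    ; Y-weak     = λ t t∈ → [ Y-weak I t , region-extracted-weak I rc t ] (∈-++⁻ (Ycur s) t∈)
    ; free-total = region-remaining-total I rc }
  search-step (endPass {s} _) I = record
    { T-weak     = λ t t∈ → [ T-weak I t , Y-weak I t ] (∈-++⁻ (Tcur s) t∈)
    ; Y-weak     = λ _ ()
    ; free-total = λ v _ → full-total v }

  search-run : ∀ {s s'} → Star SearchStep s s' → SearchInvariant s → SearchInvariant s'
  search-run ε            I = I
  search-run (step ◅ run) I = search-run run (search-step step I)

  lowest-region-has-tangle : ∀ {s p α Z σ A} → SearchInvariant s → RegionComputation s p α Z σ A →
                             free (reg s) ⊆ Z → ∃ λ a → a ∈ₗ A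
  lowest-region-has-tangle {s} {p} {α} {Z} {σ} I
      (_ , ((top , top∈ , pr-top) , pr≤p) , α≡p , attr , X , greatestX , _ , complete) V'⊆Z =
    let (C , bscc) = nontrivialBSCC-exists H (HGraph? V' α σ X) X (λ h → proj₁ (proj₂ h)) H-total top top∈X
        (a , a∈A , _) = complete C bscc
    in a , a∈A
    where
      V' : VSet n
      V' = free (reg s)
      open Attractor V' (Tcur s) α p (T-weak I) pr≤p α≡p
      open Lowest attr V'⊆Z (free-total I)
      open Invariant (attractor-invariant attr)
      H : Fin n → Fin n → Set
      H = HGraph V' α σ X
      Z⊆X : Z ⊆ X
      Z⊆X = Z⊆greatestX greatestX
      top∈X : top ∈ X
      top∈X = Z⊆X top (Top⊆Z top (Top⁺ top∈ pr-top))
      H-total : ∀ x → x ∈ X → ∃ (H x)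
      H-total x x∈X with proj₁ greatestX x x∈X
      ... | x∈Z , inj₁ (o , succ⊆X) =
        let (w , Exw) = free-total I x (Z⊆V' x x∈Z) in w , x∈X , succ⊆X w Exw , inj₁ (o , Exw)
      ... | _ , inj₂ (o , w , σx , w∈X) = w , x∈X , w∈X , inj₂ (o , σx)

lemma6 : ∀ {n} (G : Game n) (T₀ : List (TangleData n)) →
    (∀ t → t ∈ₗ T₀ → GameDefs.IsTangle G t) →
    ∀ s → Star (GameDefs.SearchStep G) (GameDefs.initState G T₀) s →
    ∀ p α Z σ A → GameDefs.RegionComputation G s p α Z σ A →
    (∀ v → v ∈ GameDefs.free G (GameDefs.reg s) → v ∈ Z) →
    ∃ λ a → a ∈ₗ A
lemma6 G T₀ T₀-tangles s run p α Z σ A rc V'⊆Z =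
  lowest-region-has-tangle G (search-run G run (initial-search-invariant G T₀ T₀-tangles)) rc V'⊆Z
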